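{- For all integers $n,m\geq 1$, $R(Q_n,Q_m)\leq mn+n+m$.
   Context: $Q_N$ denotes the Boolean lattice of dimension $N$: the power set $2^{[N]}$ ordered by inclusion. For posets $P,P'$, an embedding of $P$ into $P'$ is an injective map $f$ with $x\leq y$ in $P$ iff $f(x)\leq f(y)$ in $P'$; its image is a copy of $P$. For finite posets $P,P'$, $R(P,P')$ is the smallest $N$ such that every red/blue coloring of the elements of $Q_N$ contains a copy of $P$ with all elements red or a copy of $P'$ with all elements blue. -}

module Defs where

open import Data.Nat using (ℕ)
open import Data.Bool using (Bool; true; false)
open import Data.Fin.Subset using (Subset; _⊆_)
open import Data.Product using (Σ; ∃; _×_)
open import Data.Sum using (_⊎_)
open import Function.Bundles using (_⇔_)
open import Function.Definitions using (Injective)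
open import Relation.Binary.PropositionalEquality using (_≡_)

-- The Boolean lattice Q_N: subsets of [N] (Subset N = Vec Bool N), ordered by ⊆.

record Embedding (n N : ℕ) : Set where
  field
    map       : Subset n → Subset N
    injective : Injective _≡_ _≡_ map
    order     : ∀ x y → (x ⊆ y) ⇔ (map x ⊆ map y)

-- A red/blue colouring of Q_N: true = red, false = blue.
Colouring : ℕ → Set
Colouring N = Subset N → Bool

MonoCopy : ∀ {N} → Colouring N → Bool → ℕ → Set
MonoCopy {N} c b n =
  Σ (Embedding n N) λ e → ∀ x → c (Embedding.map e x) ≡ b

-- Every red/blue colouring of Q_N contains a red Q_n or a blue Q_m.
-- R(Q_n, Q_m) is the least N with this property.
RamseyProperty : ℕ → ℕ → ℕ → Set
RamseyProperty n m N =
  (c : Colouring N) → MonoCopy c true n ⊎ MonoCopy c false m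

-- Take the ground set [m] ⊎ L₀ ⊎ … ⊎ L_m, each level L_i a copy of [n], so N = m + (m+1)n.
-- Visiting the subsets S ⊆ [m] along a linear extension of ⊆, set
--   f S = S ∪ ⋃_{T ⊊ S} f T ∪ A_S   with A_S ⊆ L_{|S|}
-- and A_S chosen so that f S is blue. The part before A_S uses only levels below |S|,
-- so if no choice of A_S is blue, these sets form a red copy of Q_n. Otherwise f is a
-- blue copy of Q_m: it is monotone by construction and reflects ⊆ since f S ∩ [m] = S.
module Submission where

open import Defs
open import Data.Bool using (Bool; true; false; T; _∨_; _∧_)
open import Data.Bool.Properties using (T-∨; ¬-not)
import Data.Bool.Properties as Bool
open import Data.Empty using (⊥; ⊥-elim)
open import Data.Fin using (Fin; toℕ; fromℕ<; _≟_)
open import Data.Fin.Properties using (toℕ-fromℕ<; +↔⊎; *↔×)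
open import Data.Fin.Subset using (Subset; _⊆_; _∈_; inside; outside; ∣_∣)
open import Data.Fin.Subset.Properties
  using (_∈?_; anySubset?; ⊆-refl; ⊆-antisym; out⊆; in⊆in; drop-∷-⊆)
open import Data.Nat using (ℕ; zero; suc; _+_; _*_; _≤_; _<_)
open import Data.Nat.Properties
  using (≤-reflexive; ≤-<-trans; <-≤-trans; <-irrefl; n≤1+n; n<1+n; +-monoʳ-≤; +-suc; +-comm)
open import Data.Product using (∃; Σ; _×_; _,_; proj₂)
open import Data.Sum as Sum using (_⊎_; inj₁; inj₂; [_,_]′)
open import Data.Sum.Function.Propositional using (_⊎-cong_)
open import Data.Vec using ([]; _∷_; tabulate; here)
open import Data.Vec.Properties using (lookup∘tabulate; []=⇒lookup; lookup⇒[]=)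
open import Function using (_∘_; id)
open import Function.Bundles using (_⇔_; mk⇔; Equivalence; _↠_; Surjection)
open import Function.Properties.Equivalence using () renaming (sym to ⇔-sym; trans to ⇔-trans)
open import Function.Properties.Inverse using (↔-refl; ↔-trans; ↔⇒↠)
open import Relation.Binary.PropositionalEquality using (_≡_; refl; sym; trans; cong; subst)
open import Relation.Nullary using (yes; no)
open import Relation.Nullary.Decidable using (⌊_⌋; toWitness; fromWitness)

Fam : Set → Set
Fam G = G → Bool

module _ {G : Set} where

  infix 4 _⊑_
  infixl 6 _⊔_

  record _⊑_ (g h : Fam G) : Set where
    constructor mk⊑
    field
      included : ∀ x → T (g x) → T (h x)

  open _⊑_ public

  _⊔_ : Fam G → Fam G → Fam G
  (g ⊔ h) x = g x ∨ h x

  ⊑-refl : ∀ {g} → g ⊑ g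
  ⊑-refl = mk⊑ λ x t → t

  ⊑-trans : ∀ {g h k} → g ⊑ h → h ⊑ k → g ⊑ k
  ⊑-trans p q = mk⊑ λ x → included q x ∘ included p x

  ⊔-upperˡ : ∀ {g h} → g ⊑ g ⊔ h
  ⊔-upperˡ = mk⊑ λ x → Equivalence.from T-∨ ∘ inj₁

  ⊔-upperʳ : ∀ {g h} → h ⊑ g ⊔ h
  ⊔-upperʳ = mk⊑ λ x → Equivalence.from T-∨ ∘ inj₂

  ⊔-lub : ∀ {g h k} → g ⊑ k → h ⊑ k → g ⊔ h ⊑ k
  ⊔-lub p q = mk⊑ λ x → [ included p x , included q x ]′ ∘ Equivalence.to T-∨

  ⊔-mono : ∀ {g g′ h h′} → g ⊑ g′ → h ⊑ h′ → g ⊔ h ⊑ g′ ⊔ h′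
  ⊔-mono p q = ⊔-lub (⊑-trans p ⊔-upperˡ) (⊑-trans q ⊔-upperʳ)

record CubeEmbedding (k : ℕ) (G : Set) : Set where
  field
    map   : Subset k → Fam G
    order : ∀ S T → S ⊆ T ⇔ map S ⊑ map T

MonoCubeCopy : ∀ {G} → (Fam G → Bool) → Bool → ℕ → Set
MonoCubeCopy {G} col b k =
  Σ (CubeEmbedding k G) λ e → ∀ S → col (CubeEmbedding.map e S) ≡ b

module Transfer {N} {G : Set} (π : Fin N ↠ G) where
  open Surjection π using (to; strictlySurjective)

  toSubset : Fam G → Subset N
  toSubset g = tabulate (g ∘ to)

  ∈-toSubset⁻ : ∀ g {x} → x ∈ toSubset g → T (g (to x))
  ∈-toSubset⁻ g {x} x∈ =
    Equivalence.from Bool.T-≡ (trans (sym (lookup∘tabulate (g ∘ to) x)) ([]=⇒lookup x∈))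

  ∈-toSubset⁺ : ∀ g {x} → T (g (to x)) → x ∈ toSubset g
  ∈-toSubset⁺ g {x} t =
    lookup⇒[]= x _ (trans (lookup∘tabulate (g ∘ to) x) (Equivalence.to Bool.T-≡ t))

  toSubset-⊆⇔⊑ : ∀ {g h} → toSubset g ⊆ toSubset h ⇔ g ⊑ h
  toSubset-⊆⇔⊑ {g} {h} =
    mk⇔ reflect (λ le x∈ → ∈-toSubset⁺ h (included le _ (∈-toSubset⁻ g x∈)))
    where
    reflect : toSubset g ⊆ toSubset h → g ⊑ h
    included (reflect s) y t with strictlySurjective y
    ... | x , refl = ∈-toSubset⁻ h (s (∈-toSubset⁺ g t))

  embedding : ∀ {k} → CubeEmbedding k G → Embedding k N
  embedding e = record
    { map       = toSubset ∘ map
    ; injective = λ {S} {T} eq → ⊆-antisym (reflect S T eq) (reflect T S (sym eq))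
    ; order     = λ S T → ⇔-trans (order S T) (⇔-sym toSubset-⊆⇔⊑)
    }
    where
    open CubeEmbedding e
    reflect : ∀ S T → toSubset (map S) ≡ toSubset (map T) → S ⊆ T
    reflect S T eq = Equivalence.from (order S T)
      (Equivalence.to toSubset-⊆⇔⊑ (subst (toSubset (map S) ⊆_) eq id))

  monoCopy : ∀ {c : Colouring N} {b k} → MonoCubeCopy (c ∘ toSubset) b k → MonoCopy c b k
  monoCopy (e , colour) = embedding e , colour

module Layers {I : Set} {L n : ℕ} (col : Fam (I ⊎ (Fin L × Fin n)) → Bool) where

  Ground : Set
  Ground = I ⊎ (Fin L × Fin n)

  onI : Fam Ground → Fam I
  onI g i = g (inj₁ i)

  onI-mono : ∀ {g h} → g ⊑ h → onI g ⊑ onI h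
  onI-mono le = mk⊑ (included le ∘ inj₁)

  record Below (k : ℕ) (g : Fam Ground) : Set where
    constructor mkBelow
    field
      level< : ∀ ℓ p → T (g (inj₂ (ℓ , p))) → toℕ ℓ < k

  open Below

  Below-mono : ∀ {j k g} → j ≤ k → Below j g → Below k g
  Below-mono j≤k b = mkBelow λ ℓ p t → <-≤-trans (level< b ℓ p t) j≤k

  Below-⊔ : ∀ {k g h} → Below k g → Below k h → Below k (g ⊔ h)
  Below-⊔ bg bh = mkBelow λ ℓ p → [ level< bg ℓ p , level< bh ℓ p ]′ ∘ Equivalence.to T-∨

  layer : Fin L → Subset n → Fam Ground
  layer ℓ A (inj₁ _)        = false
  layer ℓ A (inj₂ (ℓ′ , p)) = ⌊ ℓ′ ≟ ℓ ⌋ ∧ ⌊ p ∈? A ⌋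

  layer⁻ : ∀ ℓ A ℓ′ p → T (layer ℓ A (inj₂ (ℓ′ , p))) → ℓ′ ≡ ℓ × p ∈ A
  layer⁻ ℓ A ℓ′ p t with ℓ′ ≟ ℓ
  ... | yes refl = refl , toWitness t

  layer⁺ : ∀ ℓ {A p} → p ∈ A → T (layer ℓ A (inj₂ (ℓ , p)))
  layer⁺ ℓ p∈A with ℓ ≟ ℓ
  ... | yes _   = fromWitness p∈A
  ... | no ℓ≢ℓ = ⊥-elim (ℓ≢ℓ refl)

  layer-mono : ∀ ℓ {A A′} → A ⊆ A′ → layer ℓ A ⊑ layer ℓ A′
  included (layer-mono ℓ {A} s) (inj₂ (ℓ′ , p)) t with layer⁻ ℓ A ℓ′ p t
  ... | refl , p∈A = layer⁺ ℓ (s p∈A)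
  included (layer-mono ℓ s) (inj₁ _) ()

  Below-layer : ∀ ℓ A → Below (suc (toℕ ℓ)) (layer ℓ A)
  level< (Below-layer ℓ A) ℓ′ p t with layer⁻ ℓ A ℓ′ p t
  ... | refl , _ = n<1+n (toℕ ℓ′)

  onI-⊔-layer : ∀ {g ℓ A} → onI (g ⊔ layer ℓ A) ⊑ onI g
  onI-⊔-layer = mk⊑ λ i → [ id , (λ ()) ]′ ∘ Equivalence.to T-∨

  layerCube : ∀ ℓ base → Below (toℕ ℓ) base → CubeEmbedding n Ground
  layerCube ℓ base below = record
    { map   = λ A → base ⊔ layer ℓ A
    ; order = λ A A′ → mk⇔ (λ (s : A ⊆ A′) → ⊔-mono ⊑-refl (layer-mono ℓ s)) (reflect A′)
    }
    where
    fresh : ∀ A′ {p} → T ((base ⊔ layer ℓ A′) (inj₂ (ℓ , p))) → p ∈ A′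
    fresh A′ {p} = [ (λ t → ⊥-elim (<-irrefl refl (level< below ℓ p t)))
                   , proj₂ ∘ layer⁻ ℓ A′ ℓ p
                   ]′ ∘ Equivalence.to T-∨
    reflect : ∀ {A} A′ → base ⊔ layer ℓ A ⊑ base ⊔ layer ℓ A′ → A ⊆ A′
    reflect A′ le p∈A =
      fresh A′ (included (⊑-trans (⊔-upperʳ {g = base}) le) (inj₂ (ℓ , _)) (layer⁺ ℓ p∈A))

  RedCube : Set
  RedCube = MonoCubeCopy col true n

  blueLayer : ∀ ℓ base → Below (toℕ ℓ) base →
              RedCube ⊎ ∃ λ A → col (base ⊔ layer ℓ A) ≡ false
  blueLayer ℓ base below with anySubset? (λ A → col (base ⊔ layer ℓ A) Bool.≟ false)
  ... | yes blue   = inj₂ blue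
  ... | no noBlue = inj₁ (layerCube ℓ base below , λ A → ¬-not (λ bl → noBlue (A , bl)))

  CubeMap : ℕ → Set
  CubeMap m = Subset m → Fam Ground

  Monotone : ∀ {m} → CubeMap m → Set
  Monotone f = ∀ {S T} → S ⊆ T → f S ⊑ f T

  -- k counts the elements already put into S further up the recursion, so k + ∣ S ∣ is
  -- the size of the whole set and f S may use exactly one level more than its base.
  record BlueExtension {m} (k : ℕ) (base f : CubeMap m) : Set where
    field
      monotone : Monotone f
      extends  : ∀ S → base S ⊑ f S
      keepsI   : ∀ S → onI (f S) ⊑ onI (base S)
      bounded  : ∀ S → Below (suc (k + ∣ S ∣)) (f S)
      blue     : ∀ S → col (f S) ≡ false

  open BlueExtension public

  layerExtension : ∀ {k ℓ A} (base : CubeMap 0) → toℕ ℓ ≡ k + 0 →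
                   Below (k + 0) (base []) → col (base [] ⊔ layer ℓ A) ≡ false →
                   BlueExtension k base (λ _ → base [] ⊔ layer ℓ A)
  layerExtension {k} {ℓ} {A} base ℓ≡k below bl = record
    { monotone = λ { {[]} {[]} _ → ⊑-refl }
    ; extends  = λ { [] → ⊔-upperˡ }
    ; keepsI   = λ { [] → onI-⊔-layer {g = base []} {ℓ} {A} }
    ; bounded  = λ { [] → Below-⊔ (Below-mono (n≤1+n (k + 0)) below)
                                  (Below-mono (≤-reflexive (cong suc ℓ≡k)) (Below-layer ℓ A)) }
    ; blue     = λ { [] → bl }
    }

  upperBase : ∀ {m} → CubeMap (suc m) → CubeMap m → CubeMap m
  upperBase base f₀ S = base (inside ∷ S) ⊔ f₀ S

  glue : ∀ {m} → CubeMap m → CubeMap m → CubeMap (suc m)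
  glue f₀ f₁ (outside ∷ S) = f₀ S
  glue f₀ f₁ (inside ∷ S)  = f₁ S

  in⊈out : ∀ {m} {S T : Subset m} → inside ∷ S ⊆ outside ∷ T → ⊥
  in⊈out s with s here
  ... | ()

  glueExtension : ∀ {m k base f₀ f₁} → Monotone {suc m} base →
                  BlueExtension k (base ∘ (outside ∷_)) f₀ →
                  BlueExtension (suc k) (upperBase base f₀) f₁ →
                  BlueExtension k base (glue f₀ f₁)
  glueExtension {k = k} {base} {f₀} {f₁} mono e₀ e₁ = record
    { monotone = glue-mono
    ; extends  = λ { (outside ∷ S) → extends e₀ S
                   ; (inside ∷ S)  → ⊑-trans ⊔-upperˡ (extends e₁ S) }
    ; keepsI   = λ { (outside ∷ S) → keepsI e₀ S
                   ; (inside ∷ S)  → ⊑-trans (keepsI e₁ S) (⊔-lub ⊑-refl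
                                       (⊑-trans (keepsI e₀ S) (onI-mono (mono (out⊆ ⊆-refl))))) }
    ; bounded  = λ { (outside ∷ S) → bounded e₀ S
                   ; (inside ∷ S)  → Below-mono (≤-reflexive (cong suc (sym (+-suc k ∣ S ∣))))
                                                   (bounded e₁ S) }
    ; blue     = λ { (outside ∷ S) → blue e₀ S
                   ; (inside ∷ S)  → blue e₁ S }
    }
    where
    glue-mono : Monotone (glue f₀ f₁)
    glue-mono {outside ∷ S} {outside ∷ T} s = monotone e₀ (drop-∷-⊆ s)
    glue-mono {outside ∷ S} {inside ∷ T}  s =
      ⊑-trans (monotone e₀ (drop-∷-⊆ s)) (⊑-trans ⊔-upperʳ (extends e₁ T))
    glue-mono {inside ∷ S}  {outside ∷ T} s = ⊥-elim (in⊈out s)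
    glue-mono {inside ∷ S}  {inside ∷ T}  s = monotone e₁ (drop-∷-⊆ s)

  -- Subsets of [m] are handled in a linear extension of ⊆: first those without the
  -- first element, then those with it; the base of the latter absorbs the former.
  blueExtension : ∀ m k → k + m < L → (base : CubeMap m) → Monotone base →
                  (∀ S → Below (k + ∣ S ∣) (base S)) → RedCube ⊎ ∃ (BlueExtension k base)
  blueExtension zero k k<L base _ below with blueLayer (fromℕ< k<L) (base []) below′
    where
    below′ : Below (toℕ (fromℕ< k<L)) (base [])
    below′ = Below-mono (≤-reflexive (sym (toℕ-fromℕ< k<L))) (below [])
  ... | inj₁ red      = inj₁ red
  ... | inj₂ (A , bl) = inj₂ (_ , layerExtension base (toℕ-fromℕ< k<L) (below []) bl)
  blueExtension (suc m) k k+m<L base mono below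
    with blueExtension m k (≤-<-trans (+-monoʳ-≤ k (n≤1+n m)) k+m<L)
                       (base ∘ (outside ∷_)) (mono ∘ out⊆) (below ∘ (outside ∷_))
  ... | inj₁ red       = inj₁ red
  ... | inj₂ (f₀ , e₀)
    with blueExtension m (suc k) (subst (_< L) (+-suc k m) k+m<L)
                       (upperBase base f₀) (λ s → ⊔-mono (mono (in⊆in s)) (monotone e₀ s))
                       (λ S → Below-⊔ (Below-mono (≤-reflexive (+-suc k ∣ S ∣))
                                                  (below (inside ∷ S)))
                                      (bounded e₀ S))
  ... | inj₁ red       = inj₁ red
  ... | inj₂ (f₁ , e₁) = inj₂ (glue f₀ f₁ , glueExtension mono e₀ e₁)

  extensionCube : ∀ {m k base f} → (∀ {S T} → onI (base S) ⊑ onI (base T) → S ⊆ T) →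
                  BlueExtension {m} k base f → CubeEmbedding m Ground
  extensionCube {base = base} {f} reflects e = record
    { map   = f
    ; order = λ S T → mk⇔ (monotone e)
        (λ le → reflects (⊑-trans (onI-mono (extends e S)) (⊑-trans (onI-mono le) (keepsI e T))))
    }

indicator : ∀ {m} → Subset m → Fam (Fin m)
indicator S x = ⌊ x ∈? S ⌋

⊆⇔indicator-⊑ : ∀ {m} {S T : Subset m} → S ⊆ T ⇔ indicator S ⊑ indicator T
⊆⇔indicator-⊑ {S = S} {T} = mk⇔ preserve reflect
  where
  preserve : S ⊆ T → indicator S ⊑ indicator T
  preserve s = mk⊑ λ x → fromWitness ∘ s ∘ toWitness
  reflect : indicator S ⊑ indicator T → S ⊆ T
  reflect le {x} = toWitness ∘ included le x ∘ fromWitness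

coordinates : ∀ {m} {B : Set} → Subset m → Fam (Fin m ⊎ B)
coordinates S = [ indicator S , (λ _ → false) ]′

coordinates-mono : ∀ {m} {B : Set} {S T : Subset m} →
                   S ⊆ T → coordinates {B = B} S ⊑ coordinates T
included (coordinates-mono s) (inj₁ x) = included (Equivalence.to ⊆⇔indicator-⊑ s) x
included (coordinates-mono s) (inj₂ _) ()

redOrBlueCube : ∀ {m n} (col : Fam (Fin m ⊎ (Fin (suc m) × Fin n)) → Bool) →
                MonoCubeCopy col true n ⊎ MonoCubeCopy col false m
redOrBlueCube {m} col =
  Sum.map₂ (λ (f , e) → extensionCube (Equivalence.from ⊆⇔indicator-⊑) e , blue e)
    (blueExtension m 0 (n<1+n m) coordinates coordinates-mono (λ S → mkBelow λ ℓ p ()))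
  where open Layers col

theorem1 : (n m : ℕ) → 1 ≤ n → 1 ≤ m →
    ∃ λ N → N ≤ m * n + n + m × RamseyProperty n m N
theorem1 n m _ _ = m + suc m * n , ≤-reflexive size , ramsey
  where
  open Transfer (↔⇒↠ (↔-trans +↔⊎ (↔-refl ⊎-cong *↔×)))
  size : m + suc m * n ≡ m * n + n + m
  size = trans (+-comm m (n + m * n)) (cong (_+ m) (+-comm n (m * n)))
  ramsey : RamseyProperty n m (m + suc m * n)
  ramsey c = Sum.map (monoCopy {c = c}) (monoCopy {c = c}) (redOrBlueCube (c ∘ toSubset))
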